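{- Let $n \ge 4$ and let $S \subseteq \mathbb{Z}_n$ with $0 \notin S$, $S = -S$, such that the circulant graph $\mathrm{Cay}(\mathbb{Z}_n, S)$ is connected, and let $k = |S|$. If $k$ divides $n$ and $s \not\equiv s' \pmod k$ for all distinct $s, s' \in S$, then $\mathrm{Cay}(\mathbb{Z}_n, S)$ admits a total perfect code.
   Context: The Cayley (circulant) graph $\mathrm{Cay}(\mathbb{Z}_n, S)$ has vertex set $\mathbb{Z}_n$, with $u,v$ adjacent iff $v-u \in S$; its degree is $|S|$. A total perfect code in a graph $\Gamma=(V,E)$ is a subset $C \subseteq V$ such that every vertex of $\Gamma$ has exactly one neighbour in $C$. Since $k \mid n$, congruence modulo $k$ of elements of $\mathbb{Z}_n$ is well defined. -}

module Defs where

open import Data.Nat using (ℕ; _+_; _∸_; _%_; NonZero; ∣_-_∣)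
open import Data.Nat.DivMod using (m%n<n)
open import Data.Nat.Divisibility using (_∣_)
open import Data.Fin using (Fin; toℕ; fromℕ<)
open import Data.Fin.Subset using (Subset; _∈_; _∉_)
open import Data.Product using (Σ; _×_)
open import Relation.Binary.PropositionalEquality using (_≡_)

-- ℤ_n is modelled by Fin n, with arithmetic taken modulo n.
module _ {n : ℕ} .{{_ : NonZero n}} where

  [_]ₙ : ℕ → Fin n
  [ a ]ₙ = fromℕ< (m%n<n a n)

  0ₙ : Fin n
  0ₙ = [ 0 ]ₙ

  -ₙ_ : Fin n → Fin n
  -ₙ u = [ n ∸ toℕ u ]ₙ

  _-ₙ_ : Fin n → Fin n → Fin n
  v -ₙ u = [ toℕ v + (n ∸ toℕ u) ]ₙ

  Adj : Subset n → Fin n → Fin n → Set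
  Adj S u v = (v -ₙ u) ∈ S

  data Walk (S : Subset n) : Fin n → Fin n → Set where
    here : ∀ {u} → Walk S u u
    step : ∀ {u v w} → Adj S u v → Walk S v w → Walk S u w

  Connected : Subset n → Set
  Connected S = ∀ u v → Walk S u v

  Symmetric : Subset n → Set
  Symmetric S = ∀ s → s ∈ S → (-ₙ s) ∈ S

  IsTotalPerfectCode : Subset n → Subset n → Set
  IsTotalPerfectCode S C =
    ∀ v → Σ (Fin n) λ c → (c ∈ C × Adj S v c) ×
            (∀ c' → c' ∈ C → Adj S v c' → c' ≡ c)

-- congruence modulo k of natural numbers (well defined on ℤ_n when k ∣ n)
CongMod : ℕ → ℕ → ℕ → Set
CongMod k a b = k ∣ ∣ a - b ∣

-- Take C to be the vertices x with k ∣ x.  Since the k elements of S are pairwise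
-- incongruent modulo k, they represent every residue class modulo k exactly once.
-- Hence for each vertex v there is exactly one s ∈ S with k ∣ v + s, and since
-- k ∣ n this says that v has exactly one neighbour v + s in C.
module Submission where

open import Defs
open import Data.Nat using (ℕ; _≤_; NonZero)
open import Data.Nat.Divisibility using (_∣_)
open import Data.Fin using (Fin; toℕ)
open import Data.Fin.Subset using (Subset; _∈_; _∉_; ∣_∣)
open import Data.Product using (Σ)
open import Relation.Binary.PropositionalEquality using (_≡_)
open import Relation.Nullary using (¬_)

open import Data.Bool.Properties using (T-≡)
open import Data.Empty using (⊥-elim)
open import Data.Fin using (zero; suc; fromℕ<; _≟_)
open import Data.Fin.Properties using (toℕ-fromℕ<; toℕ<n; toℕ-injective; suc-injective)
open import Data.Fin.Subset using (⊥; ⁅_⁆; _∪_; _⊂_; inside; outside)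
open import Data.Fin.Subset.Properties
  using (∉⊥; ∈⊤; x∈⁅x⁆; x∈⁅y⁆⇒x≡y; x∈p∪q⁺; x∈p∪q⁻; p⊂q⇒∣p∣<∣q∣; ∣p∣≤n; ∣p∣≡n⇒p≡⊤)
open import Data.Nat using (_+_; _∸_; _%_; _/_; _*_; ∣_-_∣; z≤n; s≤s; ≢-nonZero; ≢-nonZero⁻¹)
open import Data.Nat.Properties
  using (≤-refl; ≤-total; ≤-antisym; ≤-trans; <⇒≤; +-comm; +-assoc; m+[n∸m]≡n;
         m≤n⇒∣m-n∣≡n∸m; m≤n⇒∣n-m∣≡n∸m; ∣m+n-m+o∣≡∣n-o∣; *-distribʳ-∣-∣)
open import Data.Nat.DivMod
  using (m%n<n; m<n⇒m%n≡m; m%n%n≡m%n; %-distribˡ-+; [m+n]%n≡m%n; m≡m%n+[m/n]*n)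
open import Data.Nat.Divisibility
  using (_∣?_; n∣m*n; ∣m+n∣m⇒∣n; 0∣⇒≡0; %-presˡ-∣; ∣n∣m%n⇒∣m; m%n≡0⇒n∣m; n∣m⇒m%n≡0)
open import Data.Product using (_,_; _×_; ∃)
open import Data.Sum using (inj₁; inj₂)
open import Data.Vec using (_∷_; []; tabulate)
open import Data.Vec.Base using (_[_]=_)
open import Data.Vec.Properties using (lookup⇒[]=; []=⇒lookup; lookup∘tabulate)
open import Function using (_∘_; Equivalence)
open import Relation.Binary.PropositionalEquality using (sym; trans; cong; cong₂; subst; module ≡-Reasoning)
open import Relation.Nullary.Decidable using (⌊_⌋; toWitness; fromWitness; decidable-stable)

open _[_]=_

image : ∀ {n m} → (Fin n → Fin m) → Subset n → Subset m
image f []            = ⊥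
image f (inside ∷ p)  = ⁅ f zero ⁆ ∪ image (f ∘ suc) p
image f (outside ∷ p) = image (f ∘ suc) p

∈-image⁻ : ∀ {n m} (f : Fin n → Fin m) (p : Subset n) {y} →
           y ∈ image f p → ∃ λ x → x ∈ p × f x ≡ y
∈-image⁻ f []            y∈ = ⊥-elim (∉⊥ y∈)
∈-image⁻ f (outside ∷ p) y∈ with x , x∈p , fx≡y ← ∈-image⁻ (f ∘ suc) p y∈ = suc x , there x∈p , fx≡y
∈-image⁻ f (inside ∷ p)  y∈ with x∈p∪q⁻ ⁅ f zero ⁆ (image (f ∘ suc) p) y∈
... | inj₁ y∈⁅f0⁆ = zero , here , sym (x∈⁅y⁆⇒x≡y _ y∈⁅f0⁆)
... | inj₂ y∈img with x , x∈p , fx≡y ← ∈-image⁻ (f ∘ suc) p y∈img = suc x , there x∈p , fx≡y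

InjectiveOn : ∀ {n m} → (Fin n → Fin m) → Subset n → Set
InjectiveOn f p = ∀ {x y} → x ∈ p → y ∈ p → f x ≡ f y → x ≡ y

∣p∣≤∣image∣ : ∀ {n m} (f : Fin n → Fin m) (p : Subset n) → InjectiveOn f p → ∣ p ∣ ≤ ∣ image f p ∣
∣p∣≤∣image∣ f []            inj = z≤n
∣p∣≤∣image∣ f (outside ∷ p) inj =
  ∣p∣≤∣image∣ (f ∘ suc) p (λ x∈ y∈ eq → suc-injective (inj (there x∈) (there y∈) eq))
∣p∣≤∣image∣ f (inside ∷ p)  inj =
  ≤-trans (s≤s (∣p∣≤∣image∣ (f ∘ suc) p λ x∈ y∈ eq → suc-injective (inj (there x∈) (there y∈) eq)))
          (p⊂q⇒∣p∣<∣q∣ img⊂⁅f0⁆∪img)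
  where
  f0∉img : f zero ∉ image (f ∘ suc) p
  f0∉img f0∈ with x , x∈p , fx≡f0 ← ∈-image⁻ (f ∘ suc) p f0∈ with () ← inj (there x∈p) here fx≡f0

  img⊂⁅f0⁆∪img : image (f ∘ suc) p ⊂ ⁅ f zero ⁆ ∪ image (f ∘ suc) p
  img⊂⁅f0⁆∪img = (λ y∈ → x∈p∪q⁺ (inj₂ y∈)) , f zero , x∈p∪q⁺ (inj₁ (x∈⁅x⁆ (f zero))) , f0∉img

injectiveOn⇒surjectiveOn : ∀ {n m} (f : Fin n → Fin m) (p : Subset n) → InjectiveOn f p →
                           m ≤ ∣ p ∣ → ∀ y → ∃ λ x → x ∈ p × f x ≡ y
injectiveOn⇒surjectiveOn {m = m} f p inj m≤∣p∣ y =
  ∈-image⁻ f p (subst (y ∈_) (sym (∣p∣≡n⇒p≡⊤ ∣image∣≡m)) ∈⊤)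
  where
  ∣image∣≡m : ∣ image f p ∣ ≡ m
  ∣image∣≡m = ≤-antisym (∣p∣≤n (image f p)) (≤-trans m≤∣p∣ (∣p∣≤∣image∣ f p inj))

[m%d+n]%d≡[m+n]%d : ∀ m n d .{{_ : NonZero d}} → (m % d + n) % d ≡ (m + n) % d
[m%d+n]%d≡[m+n]%d m n d = begin
  (m % d + n) % d         ≡⟨ %-distribˡ-+ (m % d) n d ⟩
  (m % d % d + n % d) % d ≡⟨ cong (λ r → (r + n % d) % d) (m%n%n≡m%n m d) ⟩
  (m % d + n % d) % d     ≡⟨ %-distribˡ-+ m n d ⟨
  (m + n) % d             ∎
  where open ≡-Reasoning

[m+n%d]%d≡[m+n]%d : ∀ m n d .{{_ : NonZero d}} → (m + n % d) % d ≡ (m + n) % d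
[m+n%d]%d≡[m+n]%d m n d = begin
  (m + n % d) % d ≡⟨ cong (_% d) (+-comm m (n % d)) ⟩
  (n % d + m) % d ≡⟨ [m%d+n]%d≡[m+n]%d n m d ⟩
  (n + m) % d     ≡⟨ cong (_% d) (+-comm n m) ⟩
  (m + n) % d     ∎
  where open ≡-Reasoning

%≡⇒CongMod : ∀ d .{{_ : NonZero d}} a b → a % d ≡ b % d → CongMod d a b
%≡⇒CongMod d a b a%d≡b%d = subst (d ∣_) (sym ∣a-b∣≡∣a/d-b/d∣*d) (n∣m*n ∣ a / d - b / d ∣)
  where
  open ≡-Reasoning
  ∣a-b∣≡∣a/d-b/d∣*d : ∣ a - b ∣ ≡ ∣ a / d - b / d ∣ * d
  ∣a-b∣≡∣a/d-b/d∣*d = begin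
    ∣ a - b ∣                                 ≡⟨ cong₂ ∣_-_∣ (m≡m%n+[m/n]*n a d) (m≡m%n+[m/n]*n b d) ⟩
    ∣ a % d + a / d * d - b % d + b / d * d ∣ ≡⟨ cong (λ r → ∣ a % d + a / d * d - r + b / d * d ∣) a%d≡b%d ⟨
    ∣ a % d + a / d * d - a % d + b / d * d ∣ ≡⟨ ∣m+n-m+o∣≡∣n-o∣ (a % d) _ _ ⟩
    ∣ a / d * d - b / d * d ∣                 ≡⟨ *-distribʳ-∣-∣ d (a / d) (b / d) ⟨
    ∣ a / d - b / d ∣ * d                     ∎

∣m∣n⇒∣∣m-n∣ : ∀ {d} m n → d ∣ m → d ∣ n → d ∣ ∣ m - n ∣
∣m∣n⇒∣∣m-n∣ {d} m n d∣m d∣n with ≤-total m n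
... | inj₁ m≤n = subst (d ∣_) (sym (m≤n⇒∣m-n∣≡n∸m m≤n))
                   (∣m+n∣m⇒∣n (subst (d ∣_) (sym (m+[n∸m]≡n m≤n)) d∣n) d∣m)
... | inj₂ n≤m = subst (d ∣_) (sym (m≤n⇒∣n-m∣≡n∸m n≤m))
                   (∣m+n∣m⇒∣n (subst (d ∣_) (sym (m+[n∸m]≡n n≤m)) d∣m) d∣n)

CongMod-cancelˡ-+ : ∀ {d} a b c → d ∣ a + b → d ∣ a + c → CongMod d b c
CongMod-cancelˡ-+ {d} a b c d∣a+b d∣a+c =
  subst (d ∣_) (∣m+n-m+o∣≡∣n-o∣ a b c) (∣m∣n⇒∣∣m-n∣ (a + b) (a + c) d∣a+b d∣a+c)

module _ {n : ℕ} .{{_ : NonZero n}} where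

  toℕ-[]ₙ : ∀ a → toℕ ([_]ₙ {n} a) ≡ a % n
  toℕ-[]ₙ a = toℕ-fromℕ< (m%n<n a n)

  [u+x+[n∸u]]%n≡x : (u x : Fin n) → (toℕ u + toℕ x + (n ∸ toℕ u)) % n ≡ toℕ x
  [u+x+[n∸u]]%n≡x u x = begin
    (toℕ u + toℕ x + (n ∸ toℕ u)) % n   ≡⟨ cong (λ r → (r + (n ∸ toℕ u)) % n) (+-comm (toℕ u) (toℕ x)) ⟩
    (toℕ x + toℕ u + (n ∸ toℕ u)) % n   ≡⟨ cong (_% n) (+-assoc (toℕ x) (toℕ u) _) ⟩
    (toℕ x + (toℕ u + (n ∸ toℕ u))) % n ≡⟨ cong (λ r → (toℕ x + r) % n) (m+[n∸m]≡n (<⇒≤ (toℕ<n u))) ⟩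
    (toℕ x + n) % n                     ≡⟨ [m+n]%n≡m%n (toℕ x) n ⟩
    toℕ x % n                           ≡⟨ m<n⇒m%n≡m (toℕ<n x) ⟩
    toℕ x                               ∎
    where open ≡-Reasoning

  [u+x]-u≡x : (u x : Fin n) → [_]ₙ {n} (toℕ u + toℕ x) -ₙ u ≡ x
  [u+x]-u≡x u x = toℕ-injective (begin
    toℕ ([_]ₙ {n} (toℕ u + toℕ x) -ₙ u)           ≡⟨ toℕ-[]ₙ _ ⟩
    (toℕ ([_]ₙ {n} (toℕ u + toℕ x)) + (n ∸ toℕ u)) % n
                                                 ≡⟨ cong (λ r → (r + (n ∸ toℕ u)) % n) (toℕ-[]ₙ _) ⟩
    ((toℕ u + toℕ x) % n + (n ∸ toℕ u)) % n       ≡⟨ [m%d+n]%d≡[m+n]%d (toℕ u + toℕ x) _ n ⟩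
    (toℕ u + toℕ x + (n ∸ toℕ u)) % n             ≡⟨ [u+x+[n∸u]]%n≡x u x ⟩
    toℕ x                                         ∎)
    where open ≡-Reasoning

  [u+[v-u]]≡v : (u v : Fin n) → [_]ₙ {n} (toℕ u + toℕ (v -ₙ u)) ≡ v
  [u+[v-u]]≡v u v = toℕ-injective (begin
    toℕ ([_]ₙ {n} (toℕ u + toℕ (v -ₙ u)))           ≡⟨ toℕ-[]ₙ _ ⟩
    (toℕ u + toℕ (v -ₙ u)) % n                       ≡⟨ cong (λ r → (toℕ u + r) % n) (toℕ-[]ₙ _) ⟩
    (toℕ u + (toℕ v + (n ∸ toℕ u)) % n) % n          ≡⟨ [m+n%d]%d≡[m+n]%d (toℕ u) _ n ⟩
    (toℕ u + (toℕ v + (n ∸ toℕ u))) % n              ≡⟨ cong (_% n) (+-assoc (toℕ u) (toℕ v) _) ⟨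
    (toℕ u + toℕ v + (n ∸ toℕ u)) % n                ≡⟨ [u+x+[n∸u]]%n≡x u v ⟩
    toℕ v                                            ∎)
    where open ≡-Reasoning

multiplesOf : ∀ {n} → ℕ → Subset n
multiplesOf k = tabulate (λ x → ⌊ k ∣? toℕ x ⌋)

∈-multiplesOf⁺ : ∀ {n k} {x : Fin n} → k ∣ toℕ x → x ∈ multiplesOf k
∈-multiplesOf⁺ {k = k} {x} k∣x =
  lookup⇒[]= x _ (trans (lookup∘tabulate _ x) (Equivalence.to T-≡ (fromWitness k∣x)))

∈-multiplesOf⁻ : ∀ {n k} {x : Fin n} → x ∈ multiplesOf k → k ∣ toℕ x
∈-multiplesOf⁻ {k = k} {x} x∈ =
  toWitness (Equivalence.from T-≡ (trans (sym (lookup∘tabulate _ x)) ([]=⇒lookup x∈)))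

module _ {n : ℕ} .{{_ : NonZero n}} {k : ℕ} (k∣n : k ∣ n) (S : Subset n) where

  [v+s]-uniqueCodeNeighbour : ∀ v s → s ∈ S → k ∣ toℕ v + toℕ s →
    (∀ s' → s' ∈ S → CongMod k (toℕ s) (toℕ s') → s ≡ s') →
    Σ (Fin n) λ c → (c ∈ multiplesOf k × Adj S v c) ×
      (∀ c' → c' ∈ multiplesOf k → Adj S v c' → c' ≡ c)
  [v+s]-uniqueCodeNeighbour v s s∈S k∣v+s congruent⇒≡ = c , (c∈C , adj) , unique
    where
    c : Fin n
    c = [_]ₙ {n} (toℕ v + toℕ s)

    c∈C : c ∈ multiplesOf k
    c∈C = ∈-multiplesOf⁺ (subst (k ∣_) (sym (toℕ-[]ₙ _)) (%-presˡ-∣ k∣v+s k∣n))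

    adj : Adj S v c
    adj = subst (_∈ S) (sym ([u+x]-u≡x v s)) s∈S

    unique : ∀ c' → c' ∈ multiplesOf k → Adj S v c' → c' ≡ c
    unique c' c'∈C c'-v∈S = begin
      c'                           ≡⟨ [u+[v-u]]≡v v c' ⟨
      [ toℕ v + toℕ (c' -ₙ v) ]ₙ   ≡⟨ cong (λ x → [ toℕ v + toℕ x ]ₙ) s≡c'-v ⟨
      c                            ∎
      where
      open ≡-Reasoning
      k∣v+[c'-v] : k ∣ toℕ v + toℕ (c' -ₙ v)
      k∣v+[c'-v] = ∣n∣m%n⇒∣m k∣n
        (subst (k ∣_) (trans (cong toℕ (sym ([u+[v-u]]≡v v c'))) (toℕ-[]ₙ _)) (∈-multiplesOf⁻ c'∈C))
      s≡c'-v : s ≡ c' -ₙ v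
      s≡c'-v = congruent⇒≡ (c' -ₙ v) c'-v∈S (CongMod-cancelˡ-+ (toℕ v) _ _ k∣v+s k∣v+[c'-v])

  module _ .{{_ : NonZero k}}
           (incongruent : ∀ s s' → s ∈ S → s' ∈ S → ¬ s ≡ s' → ¬ CongMod k (toℕ s) (toℕ s'))
           where

    residue : ℕ → Fin k
    residue a = fromℕ< (m%n<n a k)

    residue-≡⇒%≡ : ∀ a b → residue a ≡ residue b → a % k ≡ b % k
    residue-≡⇒%≡ a b eq =
      trans (sym (toℕ-fromℕ< (m%n<n a k))) (trans (cong toℕ eq) (toℕ-fromℕ< (m%n<n b k)))

    CongMod⇒≡ : ∀ {s} → s ∈ S → ∀ s' → s' ∈ S → CongMod k (toℕ s) (toℕ s') → s ≡ s'
    CongMod⇒≡ {s} s∈S s' s'∈S s≡s' =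
      decidable-stable (s ≟ s') (λ s≢s' → incongruent s s' s∈S s'∈S s≢s' s≡s')

    residue-injectiveOn : InjectiveOn (residue ∘ toℕ) S
    residue-injectiveOn {x} {y} x∈S y∈S eq =
      CongMod⇒≡ x∈S y y∈S (%≡⇒CongMod k (toℕ x) (toℕ y) (residue-≡⇒%≡ (toℕ x) (toℕ y) eq))

    -- n ∸ v stands for -v modulo k, because v + (n ∸ v) = n and k ∣ n.
    s≡-v⇒k∣v+s : ∀ (v s : Fin n) → toℕ s % k ≡ (n ∸ toℕ v) % k → k ∣ toℕ v + toℕ s
    s≡-v⇒k∣v+s v s s≡-v = m%n≡0⇒n∣m _ k (begin
      (toℕ v + toℕ s) % k           ≡⟨ [m+n%d]%d≡[m+n]%d (toℕ v) (toℕ s) k ⟨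
      (toℕ v + toℕ s % k) % k       ≡⟨ cong (λ r → (toℕ v + r) % k) s≡-v ⟩
      (toℕ v + (n ∸ toℕ v) % k) % k ≡⟨ [m+n%d]%d≡[m+n]%d (toℕ v) _ k ⟩
      (toℕ v + (n ∸ toℕ v)) % k     ≡⟨ cong (_% k) (m+[n∸m]≡n (<⇒≤ (toℕ<n v))) ⟩
      n % k                         ≡⟨ n∣m⇒m%n≡0 n k k∣n ⟩
      0                             ∎)
      where open ≡-Reasoning

    multiplesOf-isTotalPerfectCode : k ≤ ∣ S ∣ → IsTotalPerfectCode S (multiplesOf k)
    multiplesOf-isTotalPerfectCode k≤∣S∣ v
      with s , s∈S , s≡-v ← injectiveOn⇒surjectiveOn (residue ∘ toℕ) S residue-injectiveOn k≤∣S∣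
                              (residue (n ∸ toℕ v))
      = [v+s]-uniqueCodeNeighbour v s s∈S (s≡-v⇒k∣v+s v s (residue-≡⇒%≡ _ _ s≡-v)) (CongMod⇒≡ s∈S)

lemma2p5 : (n : ℕ) .{{_ : NonZero n}} → 4 ≤ n → (S : Subset n) →
    0ₙ ∉ S → Symmetric S → Connected S →
    ∣ S ∣ ∣ n →
    (∀ s s' → s ∈ S → s' ∈ S → ¬ s ≡ s' → ¬ CongMod ∣ S ∣ (toℕ s) (toℕ s')) →
    Σ (Subset n) λ C → IsTotalPerfectCode S C
lemma2p5 n _ S _ _ _ ∣S∣∣n incongruent =
  multiplesOf ∣ S ∣ , multiplesOf-isTotalPerfectCode {{_}} ∣S∣∣n S {{∣S∣≢0}} incongruent ≤-refl
  where
  ∣S∣≢0 : NonZero ∣ S ∣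
  ∣S∣≢0 = ≢-nonZero λ ∣S∣≡0 → ≢-nonZero⁻¹ n (0∣⇒≡0 (subst (_∣ n) ∣S∣≡0 ∣S∣∣n))
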